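{- Let $(\{0,1,\ldots,n-1\},d)$ be a metric space, $h\ge 2$ an integer, $t$ a prime in $[\lceil n^{1/h}\rceil,\,2\lceil n^{1/h}\rceil]$, and $\sigma\in\{0,1\}$ with $\gcd(t,n-\sigma)=1$. Let $$\alpha=\mathrm{argmin}_{i=0}^{n-\sigma-1}\Big(\chi[\sigma=1]\cdot d(i,n-1)+\sum_{j=0}^{n-\sigma-1}\hat d\big(i,\,it^h+j\bmod (n-\sigma)\big)\Big),$$ breaking ties arbitrarily. Then $$\sum_{j=0}^{n-1}d(\alpha,j)\le \chi[\sigma=1]\cdot d(\alpha,n-1)+\sum_{j=0}^{n-\sigma-1}\hat d\big(\alpha,\,\alpha t^h+j\bmod(n-\sigma)\big)$$ $$\le 2h\cdot\Big(\min_{i=0}^{n-\sigma-1}\sum_{j=0}^{n-1}d(i,j)\Big)-\chi[\sigma=1]\cdot\Big((2h-1)\cdot d(i',n-1)-\frac{1}{n-1}\sum_{j=0}^{n-2}d(i',j)\Big).$$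
   Context: A metric on $\{0,\ldots,n-1\}$ is a function $d\ge0$ that is zero exactly on the diagonal, symmetric, and satisfies the triangle inequality. For a predicate $P$, $\chi[P]=1$ if $P$ is true and $0$ otherwise. For $j\in\{0,\ldots,n-1\}$, $(s_{h-1}(j),\ldots,s_0(j))\in\{0,\ldots,t-1\}^h$ is the unique $t$-ary representation of $j$, i.e. $\sum_{r=0}^{h-1}s_r(j)t^r=j$ (it exists since $t^h\ge n$). For nonnegative integers $x,y$, $d^{(n-\sigma)}(x,y)=d(x\bmod(n-\sigma),\,y\bmod(n-\sigma))$. For $i,j\in\{0,\ldots,n-\sigma-1\}$, $$\hat d\big(i,\,it^h+j\bmod(n-\sigma)\big)=\sum_{k=0}^{h-1}d^{(n-\sigma)}\Big(it^k+\sum_{\ell=0}^{k-1}s_{h-1-\ell}(j)t^{k-1-\ell},\ it^{k+1}+\sum_{\ell=0}^{k}s_{h-1-\ell}(j)t^{k-\ell}\Big)$$ (this defines $\hat d$ on $\{0,\ldots,n-\sigma-1\}^2$ since $j\mapsto it^h+j\bmod(n-\sigma)$ is a bijection). Finally $i'=\mathrm{argmin}_{i=0}^{n-\sigma-1}\sum_{j=0}^{n-1}d(i,j)$, ties broken arbitrarily.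
   Formalization: The metric d takes rational values. -}

module Defs where

open import Data.Nat as ℕ using (ℕ; zero; suc; _∸_; _^_; _%_)
import Data.Nat.DivMod as ℕD
import Data.Nat.Properties as ℕP
open import Data.Integer using (+_)
open import Data.Rational as ℚ using (ℚ; _/_; _≤_; _+_; _*_; _⊓_)
open import Data.Product using (_×_)
open import Relation.Binary.PropositionalEquality using (_≡_)

ℕ→ℚ : ℕ → ℚ
ℕ→ℚ n = + n / 1

Σℕ : ℕ → (ℕ → ℕ) → ℕ
Σℕ zero    f = 0
Σℕ (suc k) f = Σℕ k f ℕ.+ f k

Σℚ : ℕ → (ℕ → ℚ) → ℚ
Σℚ zero    f = ℚ.0ℚ
Σℚ (suc k) f = Σℚ k f + f k

-- min_{i < k} f i   (k ≥ 1; the value for k = 0 is never used)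
minℚ : ℕ → (ℕ → ℚ) → ℚ
minℚ zero          f = ℚ.0ℚ
minℚ (suc zero)    f = f 0
minℚ (suc (suc k)) f = minℚ (suc k) f ⊓ f (suc k)

-- q / m for a natural m; only ever used with m ≥ 1 (value 0 if m = 0)
divℕ : ℚ → ℕ → ℚ
divℕ q zero    = ℚ.0ℚ
divℕ q (suc m) = q * (+ 1 / suc m)

χσ1 : ℕ → ℚ
χσ1 1 = ℚ.1ℚ
χσ1 _ = ℚ.0ℚ

IsMetric : ℕ → (ℕ → ℕ → ℚ) → Set
IsMetric n d =
  (∀ x y → x ℕ.< n → y ℕ.< n → ℚ.0ℚ ≤ d x y) ×
  (∀ x y → x ℕ.< n → y ℕ.< n → (d x y ≡ ℚ.0ℚ → x ≡ y) × (x ≡ y → d x y ≡ ℚ.0ℚ)) ×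
  (∀ x y → x ℕ.< n → y ℕ.< n → d x y ≡ d y x) ×
  (∀ x y z → x ℕ.< n → y ℕ.< n → z ℕ.< n → d x z ≤ d x y + d y z)

-- c = ⌈ n^{1/h} ⌉ : the least natural c with n ≤ c^h
IsCeilRoot : ℕ → ℕ → ℕ → Set
IsCeilRoot h n c = (n ℕ.≤ c ^ h) × (∀ m → n ℕ.≤ m ^ h → c ℕ.≤ m)

-- t-ary digit s_r(j) = ⌊ j / t^r ⌋ mod t  (t ≥ 2 in use)
digit : ℕ → ℕ → ℕ → ℕ
digit zero    r j = 0
digit (suc t) r j = (j ℕD./ (suc t ^ r)) % suc t
  where instance _ = ℕP.m^n≢0 (suc t) r

dmod : (ℕ → ℕ → ℚ) → ℕ → ℕ → ℕ → ℚ
dmod d zero    x y = d x y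
dmod d (suc N) x y = d (x % suc N) (y % suc N)

-- the k-th point of the path:  i t^k + Σ_{ℓ<k} s_{h-1-ℓ}(j) t^{k-1-ℓ}
pathPt : ℕ → ℕ → ℕ → ℕ → ℕ → ℕ
pathPt t h i j k = i ℕ.* t ^ k ℕ.+ Σℕ k (λ ℓ → digit t (h ∸ 1 ∸ ℓ) j ℕ.* t ^ (k ∸ 1 ∸ ℓ))

-- d̂(i, i t^h + j mod N) with N = n - σ
dhat : (ℕ → ℕ → ℚ) → ℕ → ℕ → ℕ → ℕ → ℕ → ℚ
dhat d N t h i j =
  Σℚ h (λ k → dmod d N (pathPt t h i j k) (pathPt t h i j (suc k)))

objective : (ℕ → ℕ → ℚ) → ℕ → ℕ → ℕ → ℕ → ℕ → ℚ
objective d n σ t h i =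
  χσ1 σ * d i (n ∸ 1) + Σℚ (n ∸ σ) (λ j → dhat d (n ∸ σ) t h i j)

-- The k-th point of the path defining d̂(i, i t^h + j) is i t^k followed by the k leading
-- t-ary digits of j, so the path runs from i to i t^h + j (mod N, where N = n - σ).  By the
-- triangle inequality d̂ dominates d(i, i t^h + j), and j ↦ i t^h + j is a bijection mod N:
-- this gives the lower bound.  For the upper bound, route every step of every path through
-- i′.  Since t is a unit mod N, for fixed j and k the k-th path point i t^k + (digits of j)
-- runs through all residues mod N as i does, so summing d(i′, ·) over all k-th points gives
-- N Σ_j d(i′, j).  Hence the objective summed over all i is at most 2hN Σ_j d(i′, j) (plus
-- N d(i′, n-1) + Σ_j d(i′, j) for the extra point when σ = 1), and the minimiser α lies below
-- the average.
module Submission where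

open import Defs
open import Data.Nat as ℕ using (ℕ; zero; suc; _∸_; _%_; _^_; z≤n; s≤s; NonZero)
import Data.Nat.Properties as ℕP
open import Data.Nat.DivMod
  using (m≡m%n+[m/n]*n; m%n%n≡m%n; [m+kn]%n≡m%n; [m+n]%n≡m%n; m%n<n; m<n⇒m%n≡m;
         %-distribˡ-+; %-distribˡ-*; /-congʳ; m/n/o≡m/[n*o]; m<n⇒m/n≡0; n/1≡n)
open import Data.Nat.GCD using (gcd; module Bézout)
open import Data.Nat.Coprimality using (gcd≡1⇒coprime; coprime-Bézout; 1-coprimeTo)
  renaming (sym to coprime-sym)
open import Data.Nat.Primality using (Prime; prime⇒nonZero)
import Data.Nat.Solver as ℕS
open import Data.Integer using (+_)
import Data.Integer.Solver as ℤS
open import Data.Rational as ℚ using (ℚ; _≤_; _+_; _*_; _-_)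
import Data.Rational.Properties as ℚP
import Data.Rational.Unnormalised as ℚᵘ
import Data.Rational.Unnormalised.Properties as ℚᵘP
open import Data.Rational.Solver using (module +-*-Solver)
open import Data.Fin using (Fin; toℕ; fromℕ<; fromℕ; inject₁)
import Data.Fin.Properties as FinP
open import Data.Fin.Permutation using (Permutation; permutation)
import Algebra.Properties.CommutativeMonoid.Sum as Sum
open import Data.Product using (Σ-syntax; _×_; _,_; proj₁; proj₂)
open import Relation.Binary.PropositionalEquality

toℚᵘ-ℕ→ℚ : ∀ k → ℚ.toℚᵘ (ℕ→ℚ k) ≡ ℚᵘ.mkℚᵘ (+ k) 0
toℚᵘ-ℕ→ℚ k = cong ℚ.toℚᵘ (ℚP.normalize-coprime (coprime-sym (1-coprimeTo k)))

ℕ→ℚ-+ : ∀ a b → ℕ→ℚ (a ℕ.+ b) ≡ ℕ→ℚ a + ℕ→ℚ b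
ℕ→ℚ-+ a b = ℚP.toℚᵘ-injective (begin
  ℚ.toℚᵘ (ℕ→ℚ (a ℕ.+ b))                ≡⟨ toℚᵘ-ℕ→ℚ (a ℕ.+ b) ⟩
  ℚᵘ.mkℚᵘ (+ (a ℕ.+ b)) 0                ≈⟨ ℚᵘ.*≡* (solve 2 (λ x y → (x :+ y) :* con (+ 1) := (x :* con (+ 1) :+ y :* con (+ 1)) :* con (+ 1)) refl (+ a) (+ b)) ⟩
  ℚᵘ.mkℚᵘ (+ a) 0 ℚᵘ.+ ℚᵘ.mkℚᵘ (+ b) 0     ≡⟨ cong₂ ℚᵘ._+_ (toℚᵘ-ℕ→ℚ a) (toℚᵘ-ℕ→ℚ b) ⟨
  ℚ.toℚᵘ (ℕ→ℚ a) ℚᵘ.+ ℚ.toℚᵘ (ℕ→ℚ b)     ≈⟨ ℚP.toℚᵘ-homo-+ (ℕ→ℚ a) (ℕ→ℚ b) ⟨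
  ℚ.toℚᵘ (ℕ→ℚ a + ℕ→ℚ b)                 ∎)
  where open ℚᵘP.≃-Reasoning
        open ℤS.+-*-Solver

ℕ→ℚ-*-inverse : ∀ m → ℕ→ℚ (suc m) * (+ 1 ℚ./ suc m) ≡ ℚ.1ℚ
ℕ→ℚ-*-inverse m = ℚP.toℚᵘ-injective (begin
  ℚ.toℚᵘ (ℕ→ℚ (suc m) * (+ 1 ℚ./ suc m))              ≈⟨ ℚP.toℚᵘ-homo-* (ℕ→ℚ (suc m)) (+ 1 ℚ./ suc m) ⟩
  ℚ.toℚᵘ (ℕ→ℚ (suc m)) ℚᵘ.* ℚ.toℚᵘ (+ 1 ℚ./ suc m)   ≡⟨ cong₂ ℚᵘ._*_ (toℚᵘ-ℕ→ℚ (suc m)) (cong ℚ.toℚᵘ (ℚP.normalize-coprime (1-coprimeTo (suc m)))) ⟩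
  ℚᵘ.mkℚᵘ (+ suc m) 0 ℚᵘ.* ℚᵘ.mkℚᵘ (+ 1) m            ≈⟨ ℚᵘ.*≡* (solve 1 (λ x → ((con (+ 1) :+ x) :* con (+ 1)) :* con (+ 1) := con (+ 1) :* (con (+ 1) :* (con (+ 1) :+ x))) refl (+ m)) ⟩
  ℚ.toℚᵘ ℚ.1ℚ                                          ∎)
  where open ℚᵘP.≃-Reasoning
        open ℤS.+-*-Solver

ℕ→ℚ-pred : ∀ {k} → 1 ℕ.≤ k → ℕ→ℚ k ≡ ℚ.1ℚ + ℕ→ℚ (k ∸ 1)
ℕ→ℚ-pred {k} 1≤k = trans (cong ℕ→ℚ (sym (ℕP.m+[n∸m]≡n 1≤k))) (ℕ→ℚ-+ 1 (k ∸ 1))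

Σℚ-cong : ∀ N {f g : ℕ → ℚ} → (∀ i → i ℕ.< N → f i ≡ g i) → Σℚ N f ≡ Σℚ N g
Σℚ-cong zero    f≡g = refl
Σℚ-cong (suc N) f≡g = cong₂ _+_ (Σℚ-cong N (λ i i< → f≡g i (ℕP.m<n⇒m<1+n i<))) (f≡g N ℕP.≤-refl)

Σℚ-mono-≤ : ∀ N {f g : ℕ → ℚ} → (∀ i → i ℕ.< N → f i ≤ g i) → Σℚ N f ≤ Σℚ N g
Σℚ-mono-≤ zero    f≤g = ℚP.≤-refl
Σℚ-mono-≤ (suc N) f≤g = ℚP.+-mono-≤ (Σℚ-mono-≤ N (λ i i< → f≤g i (ℕP.m<n⇒m<1+n i<))) (f≤g N ℕP.≤-refl)

Σℚ-distrib-+ : ∀ N (f g : ℕ → ℚ) → Σℚ N (λ i → f i + g i) ≡ Σℚ N f + Σℚ N g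
Σℚ-distrib-+ zero    f g = sym (ℚP.+-identityˡ ℚ.0ℚ)
Σℚ-distrib-+ (suc N) f g = trans (cong (_+ (f N + g N)) (Σℚ-distrib-+ N f g))
  (solve 4 (λ a b c e → (a :+ b) :+ (c :+ e) := (a :+ c) :+ (b :+ e)) refl (Σℚ N f) (Σℚ N g) (f N) (g N))
  where open +-*-Solver

Σℚ-const : ∀ N c → Σℚ N (λ _ → c) ≡ ℕ→ℚ N * c
Σℚ-const zero    c = sym (ℚP.*-zeroˡ c)
Σℚ-const (suc N) c = begin
  Σℚ N (λ _ → c) + c        ≡⟨ cong (_+ c) (Σℚ-const N c) ⟩
  ℕ→ℚ N * c + c             ≡⟨ solve 2 (λ x y → x :* y :+ y := (con ℚ.1ℚ :+ x) :* y) refl (ℕ→ℚ N) c ⟩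
  (ℚ.1ℚ + ℕ→ℚ N) * c        ≡⟨ cong (_* c) (ℕ→ℚ-+ 1 N) ⟨
  ℕ→ℚ (suc N) * c           ∎
  where open ≡-Reasoning
        open +-*-Solver

Σℚ-comm : ∀ M N (f : ℕ → ℕ → ℚ) → Σℚ M (λ i → Σℚ N (f i)) ≡ Σℚ N (λ j → Σℚ M (λ i → f i j))
Σℚ-comm zero    N f = sym (trans (Σℚ-const N ℚ.0ℚ) (ℚP.*-zeroʳ (ℕ→ℚ N)))
Σℚ-comm (suc M) N f = trans (cong (_+ Σℚ N (f M)) (Σℚ-comm M N f))
  (sym (Σℚ-distrib-+ N (λ j → Σℚ M (λ i → f i j)) (f M)))

module ΣFin = Sum ℚP.+-0-commutativeMonoid

Σℚ≡sum : ∀ N (f : ℕ → ℚ) → Σℚ N f ≡ ΣFin.sum {N} (λ i → f (toℕ i))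
Σℚ≡sum zero    f = refl
Σℚ≡sum (suc N) f = begin
  Σℚ N f + f N
    ≡⟨ cong₂ _+_ (trans (Σℚ≡sum N f) (ΣFin.sum-cong-≗ {N} (λ i → cong f (sym (FinP.toℕ-inject₁ i)))))
                 (cong f (sym (FinP.toℕ-fromℕ N))) ⟩
  ΣFin.sum {N} (λ i → f (toℕ (inject₁ i))) + f (toℕ (fromℕ N))
    ≡⟨ ΣFin.sum-init-last {N} (λ i → f (toℕ i)) ⟨
  ΣFin.sum {suc N} (λ i → f (toℕ i)) ∎
  where open ≡-Reasoning

Σℚ-reindex : ∀ N (g g⁻¹ : ℕ → ℕ) →
  (∀ x → x ℕ.< N → g x ℕ.< N) → (∀ y → y ℕ.< N → g⁻¹ y ℕ.< N) →
  (∀ x → x ℕ.< N → g⁻¹ (g x) ≡ x) → (∀ y → y ℕ.< N → g (g⁻¹ y) ≡ y) →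
  ∀ (f : ℕ → ℚ) → Σℚ N (λ x → f (g x)) ≡ Σℚ N f
Σℚ-reindex N g g⁻¹ g< g⁻¹< g⁻¹∘g g∘g⁻¹ f = begin
  Σℚ N (λ x → f (g x))                   ≡⟨ Σℚ≡sum N (λ x → f (g x)) ⟩
  ΣFin.sum {N} (λ i → f (g (toℕ i)))     ≡⟨ ΣFin.sum-cong-≗ {N} (λ i → cong f (sym (FinP.toℕ-fromℕ< _))) ⟩
  ΣFin.sum {N} (λ i → f (toℕ (G i)))     ≡⟨ ΣFin.sum-permute (λ i → f (toℕ i)) π ⟨
  ΣFin.sum {N} (λ i → f (toℕ i))         ≡⟨ Σℚ≡sum N f ⟨
  Σℚ N f                                 ∎
  where
  open ≡-Reasoning
  lift : (h : ℕ → ℕ) → (∀ x → x ℕ.< N → h x ℕ.< N) → Fin N → Fin N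
  lift h h< i = fromℕ< (h< (toℕ i) (FinP.toℕ<n i))
  G : Fin N → Fin N
  G = lift g g<
  lift-inverse : ∀ {h h′} h< h′< → (∀ x → x ℕ.< N → h (h′ x) ≡ x) → ∀ i → lift h h< (lift h′ h′< i) ≡ i
  lift-inverse {h} {h′} h< h′< inv i = FinP.toℕ-injective (begin
    toℕ (lift h h< (lift h′ h′< i)) ≡⟨ FinP.toℕ-fromℕ< _ ⟩
    h (toℕ (lift h′ h′< i))         ≡⟨ cong h (FinP.toℕ-fromℕ< _) ⟩
    h (h′ (toℕ i))                  ≡⟨ inv (toℕ i) (FinP.toℕ<n i) ⟩
    toℕ i                           ∎)
  π : Permutation N N
  π = permutation G (lift g⁻¹ g⁻¹<) (lift-inverse g< g⁻¹< g∘g⁻¹) (lift-inverse g⁻¹< g< g⁻¹∘g)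

averaging : ∀ M {o B : ℚ} (f : ℕ → ℚ) → (∀ i → i ℕ.< suc M → o ≤ f i) →
            Σℚ (suc M) f ≤ ℕ→ℚ (suc M) * B → o ≤ B
averaging M {o} {B} f o≤f Σf≤ = ℚP.*-cancelˡ-≤-pos (ℕ→ℚ (suc M)) {{ℚP.normalize-pos (suc M) 1}} (begin
  ℕ→ℚ (suc M) * o        ≡⟨ Σℚ-const (suc M) o ⟨
  Σℚ (suc M) (λ _ → o)   ≤⟨ Σℚ-mono-≤ (suc M) o≤f ⟩
  Σℚ (suc M) f           ≤⟨ Σf≤ ⟩
  ℕ→ℚ (suc M) * B        ∎)
  where open ℚP.≤-Reasoning

≤minℚ : ∀ M (f : ℕ → ℚ) {a} → (∀ i → i ℕ.< suc M → a ≤ f i) → a ≤ minℚ (suc M) f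
≤minℚ zero    f a≤f = a≤f 0 (s≤s z≤n)
≤minℚ (suc M) f a≤f = ℚP.⊓-glb (≤minℚ M f (λ i i< → a≤f i (ℕP.m<n⇒m<1+n i<))) (a≤f (suc M) ℕP.≤-refl)

Σℕ-cong : ∀ k {f g : ℕ → ℕ} → (∀ i → i ℕ.< k → f i ≡ g i) → Σℕ k f ≡ Σℕ k g
Σℕ-cong zero    f≡g = refl
Σℕ-cong (suc k) f≡g = cong₂ ℕ._+_ (Σℕ-cong k (λ i i< → f≡g i (ℕP.m<n⇒m<1+n i<))) (f≡g k ℕP.≤-refl)

*-distribˡ-Σℕ : ∀ k c (f : ℕ → ℕ) → c ℕ.* Σℕ k f ≡ Σℕ k (λ i → c ℕ.* f i)
*-distribˡ-Σℕ zero    c f = ℕP.*-zeroʳ c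
*-distribˡ-Σℕ (suc k) c f = trans (ℕP.*-distribˡ-+ c (Σℕ k f) (f k)) (cong (ℕ._+ c ℕ.* f k) (*-distribˡ-Σℕ k c f))

[m%n+o]%n≡[m+o]%n : ∀ m o n .{{_ : NonZero n}} → (m % n ℕ.+ o) % n ≡ (m ℕ.+ o) % n
[m%n+o]%n≡[m+o]%n m o n = begin
  (m % n ℕ.+ o) % n             ≡⟨ %-distribˡ-+ (m % n) o n ⟩
  (m % n % n ℕ.+ o % n) % n     ≡⟨ cong (λ z → (z ℕ.+ o % n) % n) (m%n%n≡m%n m n) ⟩
  (m % n ℕ.+ o % n) % n         ≡⟨ %-distribˡ-+ m o n ⟨
  (m ℕ.+ o) % n                 ∎
  where open ≡-Reasoning

[m+o%n]%n≡[m+o]%n : ∀ m o n .{{_ : NonZero n}} → (m ℕ.+ o % n) % n ≡ (m ℕ.+ o) % n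
[m+o%n]%n≡[m+o]%n m o n = begin
  (m ℕ.+ o % n) % n   ≡⟨ cong (_% n) (ℕP.+-comm m (o % n)) ⟩
  (o % n ℕ.+ m) % n   ≡⟨ [m%n+o]%n≡[m+o]%n o m n ⟩
  (o ℕ.+ m) % n       ≡⟨ cong (_% n) (ℕP.+-comm o m) ⟩
  (m ℕ.+ o) % n       ∎
  where open ≡-Reasoning

[m%n*o]%n≡[m*o]%n : ∀ m o n .{{_ : NonZero n}} → (m % n ℕ.* o) % n ≡ (m ℕ.* o) % n
[m%n*o]%n≡[m*o]%n m o n = begin
  (m % n ℕ.* o) % n             ≡⟨ %-distribˡ-* (m % n) o n ⟩
  (m % n % n ℕ.* (o % n)) % n   ≡⟨ cong (λ z → (z ℕ.* (o % n)) % n) (m%n%n≡m%n m n) ⟩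
  (m % n ℕ.* (o % n)) % n       ≡⟨ %-distribˡ-* m o n ⟨
  (m ℕ.* o) % n                 ∎
  where open ≡-Reasoning

IsUnitMod : (N : ℕ) .{{_ : NonZero N}} → ℕ → ℕ → Set
IsUnitMod N u v = (u ℕ.* v) % N ≡ 1 % N

module _ (M : ℕ) where
  private
    N : ℕ
    N = suc M
    instance
      N≢0 : NonZero N
      N≢0 = _

  Σℚ-translate-mod : ∀ c (f : ℕ → ℚ) → Σℚ N (λ x → f ((c ℕ.+ x) % N)) ≡ Σℚ N f
  Σℚ-translate-mod c = Σℚ-reindex N (λ x → (c ℕ.+ x) % N) (λ y → (M ℕ.* c ℕ.+ y) % N)
    (λ x _ → m%n<n (c ℕ.+ x) N) (λ y _ → m%n<n (M ℕ.* c ℕ.+ y) N)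
    (λ x x< → cancel (M ℕ.* c) c x x< (solve 3 (λ m c x → m :* c :+ (c :+ x) := x :+ c :* (con 1 :+ m)) refl M c x))
    (λ y y< → cancel c (M ℕ.* c) y y< (solve 3 (λ m c y → c :+ (m :* c :+ y) := y :+ c :* (con 1 :+ m)) refl M c y))
    where
    open ℕS.+-*-Solver
    cancel : ∀ a b x → x ℕ.< N → a ℕ.+ (b ℕ.+ x) ≡ x ℕ.+ c ℕ.* N → (a ℕ.+ (b ℕ.+ x) % N) % N ≡ x
    cancel a b x x< eq = begin
      (a ℕ.+ (b ℕ.+ x) % N) % N   ≡⟨ [m+o%n]%n≡[m+o]%n a (b ℕ.+ x) N ⟩
      (a ℕ.+ (b ℕ.+ x)) % N       ≡⟨ cong (_% N) eq ⟩
      (x ℕ.+ c ℕ.* N) % N         ≡⟨ [m+kn]%n≡m%n x c N ⟩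
      x % N                       ≡⟨ m<n⇒m%n≡m x< ⟩
      x                           ∎
      where open ≡-Reasoning

  Σℚ-scale-mod : ∀ {u v} → IsUnitMod N u v → ∀ (f : ℕ → ℚ) → Σℚ N (λ x → f ((x ℕ.* u) % N)) ≡ Σℚ N f
  Σℚ-scale-mod {u} {v} uv≡1 = Σℚ-reindex N (λ x → (x ℕ.* u) % N) (λ y → (y ℕ.* v) % N)
    (λ x _ → m%n<n (x ℕ.* u) N) (λ y _ → m%n<n (y ℕ.* v) N)
    (λ x x< → cancel u v x x< (ℕP.*-comm v u))
    (λ y y< → cancel v u y y< refl)
    where
    cancel : ∀ a b x → x ℕ.< N → b ℕ.* a ≡ u ℕ.* v → ((x ℕ.* a) % N ℕ.* b) % N ≡ x
    cancel a b x x< ba≡uv = begin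
      ((x ℕ.* a) % N ℕ.* b) % N         ≡⟨ [m%n*o]%n≡[m*o]%n (x ℕ.* a) b N ⟩
      (x ℕ.* a ℕ.* b) % N               ≡⟨ cong (_% N) (trans (ℕP.*-assoc x a b) (cong (x ℕ.*_) (trans (ℕP.*-comm a b) ba≡uv))) ⟩
      (x ℕ.* (u ℕ.* v)) % N             ≡⟨ %-distribˡ-* x (u ℕ.* v) N ⟩
      (x % N ℕ.* ((u ℕ.* v) % N)) % N   ≡⟨ cong (λ z → (x % N ℕ.* z) % N) uv≡1 ⟩
      (x % N ℕ.* (1 % N)) % N           ≡⟨ %-distribˡ-* x 1 N ⟨
      (x ℕ.* 1) % N                     ≡⟨ cong (_% N) (ℕP.*-identityʳ x) ⟩
      x % N                             ≡⟨ m<n⇒m%n≡m x< ⟩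
      x                                 ∎
      where open ≡-Reasoning

  IsUnitMod-^ : ∀ {u v} → IsUnitMod N u v → ∀ k → IsUnitMod N (u ^ k) (v ^ k)
  IsUnitMod-^ {u} {v} uv≡1 zero    = refl
  IsUnitMod-^ {u} {v} uv≡1 (suc k) = begin
    (u ^ suc k ℕ.* v ^ suc k) % N                   ≡⟨ cong (_% N) (solve 4 (λ u v a b → (u :* a) :* (v :* b) := (u :* v) :* (a :* b)) refl u v (u ^ k) (v ^ k)) ⟩
    (u ℕ.* v ℕ.* (u ^ k ℕ.* v ^ k)) % N             ≡⟨ %-distribˡ-* (u ℕ.* v) (u ^ k ℕ.* v ^ k) N ⟩
    ((u ℕ.* v) % N ℕ.* ((u ^ k ℕ.* v ^ k) % N)) % N ≡⟨ cong₂ (λ a b → (a ℕ.* b) % N) uv≡1 (IsUnitMod-^ uv≡1 k) ⟩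
    (1 % N ℕ.* (1 % N)) % N                         ≡⟨ %-distribˡ-* 1 1 N ⟨
    1 % N                                           ∎
    where open ≡-Reasoning
          open ℕS.+-*-Solver

  Σℚ-affine-mod : ∀ {u v} → IsUnitMod N u v → ∀ k c (f : ℕ → ℚ) →
                  Σℚ N (λ x → f ((x ℕ.* u ^ k ℕ.+ c) % N)) ≡ Σℚ N f
  Σℚ-affine-mod {u} uv≡1 k c f = begin
    Σℚ N (λ x → f ((x ℕ.* u ^ k ℕ.+ c) % N))        ≡⟨ Σℚ-cong N (λ x _ → cong f (reorder x)) ⟩
    Σℚ N (λ x → f ((c ℕ.+ (x ℕ.* u ^ k) % N) % N))  ≡⟨ Σℚ-scale-mod (IsUnitMod-^ uv≡1 k) (λ y → f ((c ℕ.+ y) % N)) ⟩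
    Σℚ N (λ y → f ((c ℕ.+ y) % N))                  ≡⟨ Σℚ-translate-mod c f ⟩
    Σℚ N f                                          ∎
    where
    open ≡-Reasoning
    reorder : ∀ x → (x ℕ.* u ^ k ℕ.+ c) % N ≡ (c ℕ.+ (x ℕ.* u ^ k) % N) % N
    reorder x = trans (cong (_% N) (ℕP.+-comm (x ℕ.* u ^ k) c)) (sym ([m+o%n]%n≡[m+o]%n c (x ℕ.* u ^ k) N))

  inverse-mod : ∀ t → gcd t N ≡ 1 → Σ[ w ∈ ℕ ] IsUnitMod N t w
  inverse-mod t gcd≡1 with coprime-Bézout (gcd≡1⇒coprime gcd≡1)
  ... | Bézout.+- x y 1+yN≡xt = x , (begin
    (t ℕ.* x) % N        ≡⟨ cong (_% N) (trans (ℕP.*-comm t x) (sym 1+yN≡xt)) ⟩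
    (1 ℕ.+ y ℕ.* N) % N  ≡⟨ [m+kn]%n≡m%n 1 y N ⟩
    1 % N                ∎)
    where open ≡-Reasoning
  -- here x t ≡ -1 and M ≡ -1 (mod N), so x M is an inverse of t
  ... | Bézout.-+ x y 1+xt≡yN = x ℕ.* M , (begin
    (t ℕ.* (x ℕ.* M)) % N             ≡⟨ [m+n]%n≡m%n (t ℕ.* (x ℕ.* M)) N ⟨
    (t ℕ.* (x ℕ.* M) ℕ.+ N) % N       ≡⟨ cong (_% N) (solve 3 (λ t x m → t :* (x :* m) :+ (con 1 :+ m) := (con 1 :+ x :* t) :* m :+ con 1) refl t x M) ⟩
    ((1 ℕ.+ x ℕ.* t) ℕ.* M ℕ.+ 1) % N ≡⟨ cong (λ z → (z ℕ.* M ℕ.+ 1) % N) 1+xt≡yN ⟩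
    (y ℕ.* N ℕ.* M ℕ.+ 1) % N         ≡⟨ cong (_% N) (solve 3 (λ y n m → y :* n :* m :+ con 1 := con 1 :+ y :* m :* n) refl y N M) ⟩
    (1 ℕ.+ y ℕ.* M ℕ.* N) % N         ≡⟨ [m+kn]%n≡m%n 1 (y ℕ.* M) N ⟩
    1 % N                             ∎)
    where open ≡-Reasoning
          open ℕS.+-*-Solver

pathPt-zero : ∀ t h i j → pathPt t h i j 0 ≡ i
pathPt-zero t h i j = trans (ℕP.+-identityʳ (i ℕ.* 1)) (ℕP.*-identityʳ i)

Σℕ-^∸-factor : ∀ b k (f : ℕ → ℕ) →
  Σℕ k (λ ℓ → f ℓ ℕ.* b ^ (k ∸ ℓ)) ≡ b ℕ.* Σℕ k (λ ℓ → f ℓ ℕ.* b ^ (k ∸ 1 ∸ ℓ))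
Σℕ-^∸-factor b k f = trans (Σℕ-cong k pull) (sym (*-distribˡ-Σℕ k b _))
  where
  open ℕS.+-*-Solver
  pull : ∀ ℓ → ℓ ℕ.< k → f ℓ ℕ.* b ^ (k ∸ ℓ) ≡ b ℕ.* (f ℓ ℕ.* b ^ (k ∸ 1 ∸ ℓ))
  pull ℓ (s≤s ℓ≤k-1) = trans (cong (λ e → f ℓ ℕ.* b ^ e) (ℕP.+-∸-assoc 1 ℓ≤k-1))
    (solve 3 (λ x b p → x :* (b :* p) := b :* (x :* p)) refl (f ℓ) b (b ^ (k ∸ 1 ∸ ℓ)))

module _ (t : ℕ) where
  private
    T : ℕ
    T = suc t

  infixl 7 _/T^_
  _/T^_ : ℕ → ℕ → ℕ
  j /T^ a = (j ℕ./ T ^ a) {{ℕP.m^n≢0 T a}}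

  quotient-digit : ∀ a j → j /T^ a ≡ T ℕ.* (j /T^ suc a) ℕ.+ digit T a j
  quotient-digit a j = begin
    q                           ≡⟨ m≡m%n+[m/n]*n q T ⟩
    q % T ℕ.+ q ℕ./ T ℕ.* T     ≡⟨ ℕP.+-comm (q % T) _ ⟩
    q ℕ./ T ℕ.* T ℕ.+ q % T     ≡⟨ cong (ℕ._+ q % T) (ℕP.*-comm (q ℕ./ T) T) ⟩
    T ℕ.* (q ℕ./ T) ℕ.+ q % T   ≡⟨ cong (λ z → T ℕ.* z ℕ.+ q % T) (trans (m/n/o≡m/[n*o] j (T ^ a) T) (/-congʳ (ℕP.*-comm (T ^ a) T))) ⟩
    T ℕ.* (j /T^ suc a) ℕ.+ q % T ∎
    where
    open ≡-Reasoning
    q : ℕ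
    q = j /T^ a
    instance
      T^a≢0 : NonZero (T ^ a)
      T^a≢0 = ℕP.m^n≢0 T a
      T^[1+a]≢0 : NonZero (T ^ suc a)
      T^[1+a]≢0 = ℕP.m^n≢0 T (suc a)
      T^a*T≢0 : NonZero (T ^ a ℕ.* T)
      T^a*T≢0 = ℕP.m*n≢0 (T ^ a) T

  leading-digits : ∀ h j → j ℕ.< T ^ h → ∀ k → k ℕ.≤ h →
    Σℕ k (λ ℓ → digit T (h ∸ 1 ∸ ℓ) j ℕ.* T ^ (k ∸ 1 ∸ ℓ)) ≡ j /T^ (h ∸ k)
  leading-digits h j j< zero    _   = sym (m<n⇒m/n≡0 {{ℕP.m^n≢0 T h}} j<)
  leading-digits (suc h) j j< (suc k) (s≤s k≤h) = begin
    Σℕ k (λ ℓ → s ℓ ℕ.* T ^ (k ∸ ℓ)) ℕ.+ s k ℕ.* T ^ (k ∸ k)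
      ≡⟨ cong₂ ℕ._+_ (Σℕ-^∸-factor T k s) (trans (cong (λ e → s k ℕ.* T ^ e) (ℕP.n∸n≡0 k)) (ℕP.*-identityʳ (s k))) ⟩
    T ℕ.* Σℕ k (λ ℓ → s ℓ ℕ.* T ^ (k ∸ 1 ∸ ℓ)) ℕ.+ s k
      ≡⟨ cong (λ z → T ℕ.* z ℕ.+ s k) (leading-digits (suc h) j j< k (ℕP.m≤n⇒m≤1+n k≤h)) ⟩
    T ℕ.* (j /T^ (suc h ∸ k)) ℕ.+ s k
      ≡⟨ cong (λ e → T ℕ.* (j /T^ e) ℕ.+ s k) (ℕP.+-∸-assoc 1 k≤h) ⟩
    T ℕ.* (j /T^ suc (h ∸ k)) ℕ.+ s k
      ≡⟨ quotient-digit (h ∸ k) j ⟨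
    j /T^ (h ∸ k) ∎
    where
    open ≡-Reasoning
    s : ℕ → ℕ
    s ℓ = digit T (h ∸ ℓ) j

pathPt-last : ∀ {t} .{{_ : NonZero t}} h i j → j ℕ.< t ^ h → pathPt t h i j h ≡ i ℕ.* t ^ h ℕ.+ j
pathPt-last {suc t} h i j j< = cong (i ℕ.* suc t ^ h ℕ.+_) (begin
  Σℕ h (λ ℓ → digit (suc t) (h ∸ 1 ∸ ℓ) j ℕ.* suc t ^ (h ∸ 1 ∸ ℓ)) ≡⟨ leading-digits t h j j< h ℕP.≤-refl ⟩
  _/T^_ t j (h ∸ h)                                                 ≡⟨ cong (_/T^_ t j) (ℕP.n∸n≡0 h) ⟩
  _/T^_ t j 0                                                       ≡⟨ n/1≡n j ⟩
  j                                                                 ∎)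
  where open ≡-Reasoning

module Metric {n : ℕ} {d : ℕ → ℕ → ℚ} (d-metric : IsMetric n d) where
  d-refl : ∀ {x} → x ℕ.< n → d x x ≡ ℚ.0ℚ
  d-refl {x} x< = proj₂ (proj₁ (proj₂ d-metric) x x x< x<) refl

  d-sym : ∀ {x y} → x ℕ.< n → y ℕ.< n → d x y ≡ d y x
  d-sym = proj₁ (proj₂ (proj₂ d-metric)) _ _

  d-triangle : ∀ {x y z} → x ℕ.< n → y ℕ.< n → z ℕ.< n → d x z ≤ d x y + d y z
  d-triangle = proj₂ (proj₂ (proj₂ d-metric)) _ _ _

  d≤path-length : ∀ K (p : ℕ → ℕ) → (∀ k → p k ℕ.< n) → d (p 0) (p K) ≤ Σℚ K (λ k → d (p k) (p (suc k)))
  d≤path-length zero    p p< = ℚP.≤-reflexive (d-refl (p< 0))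
  d≤path-length (suc K) p p< = ℚP.≤-trans (d-triangle (p< 0) (p< K) (p< (suc K)))
    (ℚP.+-monoˡ-≤ (d (p K) (p (suc K))) (d≤path-length K p p<))

  d≤d+d : ∀ {c x y} → c ℕ.< n → x ℕ.< n → y ℕ.< n → d x y ≤ d c x + d c y
  d≤d+d {c} {x} {y} c< x< y< = ℚP.≤-trans (d-triangle x< c< y<) (ℚP.≤-reflexive (cong (_+ d c y) (d-sym x< c<)))

  Σd≤Σd+*d : ∀ N → N ℕ.≤ n → ∀ {c z} → c ℕ.< n → z ℕ.< n → Σℚ N (λ i → d i z) ≤ Σℚ N (d c) + ℕ→ℚ N * d c z
  Σd≤Σd+*d N N≤n {c} {z} c< z< = begin
    Σℚ N (λ i → d i z)             ≤⟨ Σℚ-mono-≤ N (λ i i< → d≤d+d c< (ℕP.<-≤-trans i< N≤n) z<) ⟩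
    Σℚ N (λ i → d c i + d c z)     ≡⟨ Σℚ-distrib-+ N (d c) (λ _ → d c z) ⟩
    Σℚ N (d c) + Σℚ N (λ _ → d c z) ≡⟨ cong (λ z → Σℚ N (d c) + z) (Σℚ-const N (d c z)) ⟩
    Σℚ N (d c) + ℕ→ℚ N * d c z     ∎
    where open ℚP.≤-Reasoning

ℕ→ℚ-2* : ∀ h → ℕ→ℚ (2 ℕ.* h) ≡ ℕ→ℚ h + ℕ→ℚ h
ℕ→ℚ-2* h = trans (ℕ→ℚ-+ h (h ℕ.+ 0)) (cong (λ z → ℕ→ℚ h + ℕ→ℚ z) (ℕP.+-identityʳ h))

module PathSums {n : ℕ} {d : ℕ → ℕ → ℚ} (d-metric : IsMetric n d) (M : ℕ) (N≤n : suc M ℕ.≤ n) (t h : ℕ) where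
  open Metric d-metric
  private
    N : ℕ
    N = suc M

  point : ℕ → ℕ → ℕ → ℕ
  point i j k = pathPt t h i j k % N

  point<n : ∀ i j k → point i j k ℕ.< n
  point<n i j k = ℕP.<-≤-trans (m%n<n (pathPt t h i j k) N) N≤n

  Σd≤Σdhat : .{{_ : NonZero t}} → ∀ {α} → α ℕ.< N → N ℕ.≤ t ^ h → Σℚ N (d α) ≤ Σℚ N (dhat d N t h α)
  Σd≤Σdhat {α} α< N≤t^h = begin
    Σℚ N (d α)                                 ≡⟨ Σℚ-translate-mod M (α ℕ.* t ^ h) (d α) ⟨
    Σℚ N (λ j → d α ((α ℕ.* t ^ h ℕ.+ j) % N)) ≡⟨ Σℚ-cong N (λ j j< → cong₂ d (sym (first-point j)) (sym (last-point j j<))) ⟩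
    Σℚ N (λ j → d (point α j 0) (point α j h)) ≤⟨ Σℚ-mono-≤ N (λ j _ → d≤path-length h (point α j) (point<n α j)) ⟩
    Σℚ N (dhat d N t h α)                      ∎
    where
    open ℚP.≤-Reasoning
    first-point : ∀ j → point α j 0 ≡ α
    first-point j = trans (cong (_% N) (pathPt-zero t h α j)) (m<n⇒m%n≡m α<)
    last-point : ∀ j → j ℕ.< N → point α j h ≡ (α ℕ.* t ^ h ℕ.+ j) % N
    last-point j j< = cong (_% N) (pathPt-last h α j (ℕP.<-≤-trans j< N≤t^h))

  Σd-point : ∀ {w} → IsUnitMod N t w → ∀ c k →
           Σℚ N (λ i → Σℚ N (λ j → d c (point i j k))) ≡ ℕ→ℚ N * Σℚ N (d c)
  Σd-point tw≡1 c k = begin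
    Σℚ N (λ i → Σℚ N (λ j → d c (point i j k))) ≡⟨ Σℚ-comm N N _ ⟩
    Σℚ N (λ j → Σℚ N (λ i → d c (point i j k))) ≡⟨ Σℚ-cong N (λ j _ → Σℚ-affine-mod M tw≡1 k _ (d c)) ⟩
    Σℚ N (λ j → Σℚ N (d c))                     ≡⟨ Σℚ-const N (Σℚ N (d c)) ⟩
    ℕ→ℚ N * Σℚ N (d c)                          ∎
    where open ≡-Reasoning

  ΣΣdhat≤ : gcd t N ≡ 1 → ∀ {c} → c ℕ.< n →
            Σℚ N (λ i → Σℚ N (dhat d N t h i)) ≤ ℕ→ℚ (2 ℕ.* h) * (ℕ→ℚ N * Σℚ N (d c))
  ΣΣdhat≤ gcd≡1 {c} c< = begin
    Σℚ N (λ i → Σℚ N (λ j → Σℚ h (λ k → d (point i j k) (point i j (suc k)))))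
      ≤⟨ Σℚ-mono-≤ N (λ i _ → Σℚ-mono-≤ N (λ j _ → Σℚ-mono-≤ h (λ k _ → d≤d+d c< (point<n i j k) (point<n i j (suc k))))) ⟩
    Σℚ N (λ i → Σℚ N (λ j → Σℚ h (λ k → D i j k + D i j (suc k))))
      ≡⟨ trans (Σℚ-cong N (λ i _ → Σℚ-comm N h _)) (Σℚ-comm N h _) ⟩
    Σℚ h (λ k → Σℚ N (λ i → Σℚ N (λ j → D i j k + D i j (suc k))))
      ≡⟨ Σℚ-cong h (λ k _ → trans (Σℚ-cong N (λ i _ → Σℚ-distrib-+ N _ _)) (Σℚ-distrib-+ N _ _)) ⟩
    Σℚ h (λ k → ΣD k + ΣD (suc k))
      ≡⟨ Σℚ-cong h (λ k _ → cong₂ _+_ (Σd-point w≡ c k) (Σd-point w≡ c (suc k))) ⟩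
    Σℚ h (λ _ → X + X)
      ≡⟨ Σℚ-const h (X + X) ⟩
    ℕ→ℚ h * (X + X)
      ≡⟨ solve 2 (λ h x → h :* (x :+ x) := (h :+ h) :* x) refl (ℕ→ℚ h) X ⟩
    (ℕ→ℚ h + ℕ→ℚ h) * X
      ≡⟨ cong (_* X) (ℕ→ℚ-2* h) ⟨
    ℕ→ℚ (2 ℕ.* h) * X ∎
    where
    open ℚP.≤-Reasoning
    open +-*-Solver
    D : ℕ → ℕ → ℕ → ℚ
    D i j k = d c (point i j k)
    ΣD : ℕ → ℚ
    ΣD k = Σℚ N (λ i → Σℚ N (λ j → D i j k))
    X : ℚ
    X = ℕ→ℚ N * Σℚ N (d c)
    w≡ : IsUnitMod N t (proj₁ (inverse-mod M t gcd≡1))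
    w≡ = proj₂ (inverse-mod M t gcd≡1)

0*x+y≡y : ∀ x y → ℚ.0ℚ * x + y ≡ y
0*x+y≡y x y = trans (cong (_+ y) (ℚP.*-zeroˡ x)) (ℚP.+-identityˡ y)

module _ {M : ℕ} {d : ℕ → ℕ → ℚ} (d-metric : IsMetric (suc M) d) {t h : ℕ} where
  open PathSums d-metric M ℕP.≤-refl t h
  private
    N : ℕ
    N = suc M
    o : ℕ → ℚ
    o = objective d N 0 t h
    K : ℚ
    K = ℕ→ℚ (2 ℕ.* h)
    E : ℚ
    E = ℕ→ℚ (2 ℕ.* h ∸ 1)

  objective₀-lower : .{{_ : NonZero t}} → N ℕ.≤ t ^ h → ∀ {α} → α ℕ.< N → Σℚ N (d α) ≤ o α
  objective₀-lower N≤t^h {α} α< =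
    ℚP.≤-trans (Σd≤Σdhat α< N≤t^h) (ℚP.≤-reflexive (sym (0*x+y≡y (d α M) _)))

  objective₀-average : gcd t N ≡ 1 → ∀ {α} → (∀ i → i ℕ.< N → o α ≤ o i) →
                       ∀ {c} → c ℕ.< N → o α ≤ K * Σℚ N (d c)
  objective₀-average gcd≡1 α-min {c} c< = averaging M o α-min (begin
    Σℚ N o                              ≡⟨ Σℚ-cong N (λ i _ → 0*x+y≡y (d i M) _) ⟩
    Σℚ N (λ i → Σℚ N (dhat d N t h i))  ≤⟨ ΣΣdhat≤ gcd≡1 c< ⟩
    K * (ℕ→ℚ N * Σℚ N (d c))            ≡⟨ solve 3 (λ k q a → k :* (q :* a) := q :* (k :* a)) refl K (ℕ→ℚ N) (Σℚ N (d c)) ⟩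
    ℕ→ℚ N * (K * Σℚ N (d c))            ∎)
    where open ℚP.≤-Reasoning
          open +-*-Solver

  objective₀-upper : gcd t N ≡ 1 → ∀ {α} → (∀ i → i ℕ.< N → o α ≤ o i) →
                     ∀ {c} → c ℕ.< N → (∀ i → i ℕ.< N → Σℚ N (d c) ≤ Σℚ N (d i)) →
                     o α ≤ K * minℚ N (λ i → Σℚ N (d i)) - ℚ.0ℚ * (E * d c M - divℕ (Σℚ M (d c)) M)
  objective₀-upper gcd≡1 α-min {c} c< c-min = begin
    o _                             ≤⟨ objective₀-average gcd≡1 α-min c< ⟩
    K * Σℚ N (d _)                  ≤⟨ ℚP.*-monoˡ-≤-nonNeg K {{ℚP.normalize-nonNeg (2 ℕ.* h) 1}} (≤minℚ M _ c-min) ⟩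
    K * μ                           ≡⟨ solve 2 (λ a b → a := a :- con ℚ.0ℚ :* b) refl (K * μ) B ⟩
    K * μ - ℚ.0ℚ * B                ∎
    where
    open ℚP.≤-Reasoning
    open +-*-Solver
    μ : ℚ
    μ = minℚ N (λ i → Σℚ N (d i))
    B : ℚ
    B = E * d c M - divℕ (Σℚ M (d c)) M

module _ {M : ℕ} {d : ℕ → ℕ → ℚ} (d-metric : IsMetric (suc (suc M)) d) {t h : ℕ} where
  open Metric d-metric
  open PathSums d-metric M (ℕP.n≤1+n (suc M)) t h
  private
    N : ℕ
    N = suc M
    o : ℕ → ℚ
    o = objective d (suc N) 1 t h
    K : ℚ
    K = ℕ→ℚ (2 ℕ.* h)
    E : ℚ
    E = ℕ→ℚ (2 ℕ.* h ∸ 1)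
    r : ℚ
    r = + 1 ℚ./ N

  objective₁-lower : .{{_ : NonZero t}} → N ℕ.≤ t ^ h → ∀ {α} → α ℕ.< N → Σℚ (suc N) (d α) ≤ o α
  objective₁-lower N≤t^h {α} α< = begin
    Σℚ N (d α) + d α N                   ≤⟨ ℚP.+-monoˡ-≤ (d α N) (Σd≤Σdhat α< N≤t^h) ⟩
    Σℚ N (dhat d N t h α) + d α N        ≡⟨ trans (ℚP.+-comm _ (d α N)) (cong (_+ Σℚ N (dhat d N t h α)) (sym (ℚP.*-identityˡ (d α N)))) ⟩
    ℚ.1ℚ * d α N + Σℚ N (dhat d N t h α) ∎
    where open ℚP.≤-Reasoning

  objective₁-average : gcd t N ≡ 1 → ∀ {α} → (∀ i → i ℕ.< N → o α ≤ o i) → ∀ {c} → c ℕ.< N →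
                       o α ≤ K * Σℚ N (d c) + d c N + Σℚ N (d c) * r
  objective₁-average gcd≡1 α-min {c} c< = averaging M o α-min (begin
    Σℚ N (λ i → ℚ.1ℚ * d i N + Σℚ N (dhat d N t h i))
      ≡⟨ Σℚ-distrib-+ N _ _ ⟩
    Σℚ N (λ i → ℚ.1ℚ * d i N) + Σℚ N (λ i → Σℚ N (dhat d N t h i))
      ≤⟨ ℚP.+-mono-≤ Σd-to-last (ΣΣdhat≤ gcd≡1 c<N+1) ⟩
    (A + q * D) + K * (q * A)
      ≡⟨ cong (λ z → (z + q * D) + K * (q * A)) (trans (sym (ℚP.*-identityˡ A)) (cong (_* A) (sym (ℕ→ℚ-*-inverse M)))) ⟩
    ((q * r) * A + q * D) + K * (q * A)
      ≡⟨ solve 5 (λ q r A D K → ((q :* r) :* A :+ q :* D) :+ K :* (q :* A) := q :* (K :* A :+ D :+ A :* r)) refl q r A D K ⟩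
    q * (K * A + D + A * r) ∎)
    where
    open ℚP.≤-Reasoning
    open +-*-Solver
    A : ℚ
    A = Σℚ N (d c)
    D : ℚ
    D = d c N
    q : ℚ
    q = ℕ→ℚ N
    c<N+1 : c ℕ.< suc N
    c<N+1 = ℕP.m<n⇒m<1+n c<
    Σd-to-last : Σℚ N (λ i → ℚ.1ℚ * d i N) ≤ A + q * D
    Σd-to-last = ℚP.≤-trans (ℚP.≤-reflexive (Σℚ-cong N (λ i _ → ℚP.*-identityˡ (d i N))))
                            (Σd≤Σd+*d N (ℕP.n≤1+n N) c<N+1 ℕP.≤-refl)

  objective₁-upper : 1 ℕ.≤ h → gcd t N ≡ 1 → ∀ {α} → (∀ i → i ℕ.< N → o α ≤ o i) →
    ∀ {c} → c ℕ.< N → (∀ i → i ℕ.< N → Σℚ (suc N) (d c) ≤ Σℚ (suc N) (d i)) →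
    o α ≤ K * minℚ N (λ i → Σℚ (suc N) (d i)) - ℚ.1ℚ * (E * d c N - Σℚ N (d c) * r)
  objective₁-upper 1≤h gcd≡1 α-min {c} c< c-min = begin
    o _                            ≤⟨ objective₁-average gcd≡1 α-min c< ⟩
    K * A + D + A * r              ≡⟨ cong (λ k → k * A + D + A * r) K≡1+E ⟩
    (ℚ.1ℚ + E) * A + D + A * r     ≡⟨ solve 4 (λ E A D r → (con ℚ.1ℚ :+ E) :* A :+ D :+ A :* r := (con ℚ.1ℚ :+ E) :* (A :+ D) :- con ℚ.1ℚ :* (E :* D :- A :* r)) refl E A D r ⟩
    (ℚ.1ℚ + E) * (A + D) - B       ≡⟨ cong (λ k → k * (A + D) - B) K≡1+E ⟨
    K * (A + D) - B                ≤⟨ ℚP.+-monoˡ-≤ (ℚ.- B) (ℚP.*-monoˡ-≤-nonNeg K {{ℚP.normalize-nonNeg (2 ℕ.* h) 1}} (≤minℚ M _ c-min)) ⟩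
    K * μ - B                      ∎
    where
    open ℚP.≤-Reasoning
    open +-*-Solver
    K≡1+E : K ≡ ℚ.1ℚ + E
    K≡1+E = ℕ→ℚ-pred (ℕP.≤-trans 1≤h (ℕP.m≤m+n h (h ℕ.+ 0)))
    A : ℚ
    A = Σℚ N (d c)
    D : ℚ
    D = d c N
    B : ℚ
    B = ℚ.1ℚ * (E * D - A * r)
    μ : ℚ
    μ = minℚ N (λ i → Σℚ (suc N) (d i))

-- The hypothesis t ≤ 2c only bounds the running time.
lemma3 : (n : ℕ) (d : ℕ → ℕ → ℚ) → IsMetric n d →
    (h : ℕ) → 2 ℕ.≤ h →
    (c : ℕ) → IsCeilRoot h n c →
    (t : ℕ) → Prime t → c ℕ.≤ t → t ℕ.≤ 2 ℕ.* c →
    (σ : ℕ) → σ ℕ.≤ 1 → gcd t (n ∸ σ) ≡ 1 →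
    (α : ℕ) → α ℕ.< n ∸ σ →
    (∀ i → i ℕ.< n ∸ σ → objective d n σ t h α ≤ objective d n σ t h i) →
    (i′ : ℕ) → i′ ℕ.< n ∸ σ →
    (∀ i → i ℕ.< n ∸ σ → Σℚ n (d i′) ≤ Σℚ n (d i)) →
    (Σℚ n (d α) ≤ objective d n σ t h α)
    × (objective d n σ t h α
    ≤ ℕ→ℚ (2 ℕ.* h) * minℚ (n ∸ σ) (λ i → Σℚ n (d i))
    - χσ1 σ * (ℕ→ℚ (2 ℕ.* h ∸ 1) * d i′ (n ∸ 1)
    - divℕ (Σℚ (n ∸ 1) (d i′)) (n ∸ 1)))
lemma3 zero          _ _ _ _ _ _ _ _ _ _ zero       z≤n       _ _ () _ _ _ _
lemma3 zero          _ _ _ _ _ _ _ _ _ _ (suc zero) (s≤s z≤n) _ _ () _ _ _ _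
lemma3 (suc zero)    _ _ _ _ _ _ _ _ _ _ (suc zero) (s≤s z≤n) _ _ () _ _ _ _
lemma3 (suc M) d d-metric h _ c (n≤c^h , _) t t-prime c≤t _ zero z≤n gcd≡1 α α< α-min i′ i′< i′-min =
  objective₀-lower d-metric {t} {h} n≤t^h α< ,
  objective₀-upper d-metric {t} {h} gcd≡1 α-min i′< i′-min
  where
  instance _ = prime⇒nonZero t-prime
  n≤t^h : suc M ℕ.≤ t ^ h
  n≤t^h = ℕP.≤-trans n≤c^h (ℕP.^-monoˡ-≤ h c≤t)
lemma3 (suc (suc M)) d d-metric h 2≤h c (n≤c^h , _) t t-prime c≤t _ (suc zero) (s≤s z≤n) gcd≡1 α α< α-min i′ i′< i′-min =
  objective₁-lower d-metric {t} {h} N≤t^h α< ,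
  objective₁-upper d-metric {t} {h} (ℕP.<⇒≤ 2≤h) gcd≡1 α-min i′< i′-min
  where
  instance _ = prime⇒nonZero t-prime
  N≤t^h : suc M ℕ.≤ t ^ h
  N≤t^h = ℕP.≤-trans (ℕP.n≤1+n (suc M)) (ℕP.≤-trans n≤c^h (ℕP.^-monoˡ-≤ h c≤t))
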